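{- Let $k$, $n$ and $s$ be positive integers and let $x_1,\ldots,x_n$ be independent variables. Then $$H_k^{(s)}(x_1,\ldots,x_n)=\begin{cases}\sum_{T\in\mathcal T_{n,k}^s}X^{w_T}, & \text{if } s \text{ is odd},\\[2pt] (-1)^k\sum_{T\in\mathcal T_{n,k}^s}(-1)^{G(T)}X^{w_T}, & \text{otherwise},\end{cases}$$ where $G(T)=\sum_{m=0}^{n-1}n_m(T)$.
   Context: For a positive integer $s$, $H_k^{(s)}$ ($k\ge0$) is defined by $\sum_{k\ge0}H_k^{(s)}(x_1,\ldots,x_n)t^k=\prod_{i=1}^n\big(1-x_it+\cdots+(-x_it)^s\big)^{ -1}$. A tiling of an $(n+k-1)$-board with $k$ red and $n-1$ green squares is a word of length $n+k-1$ with exactly $k$ letters r (red) and $n-1$ letters g (green). For $m=0,1,\ldots,n-1$ let $b_m(T)$ be the number of consecutive red squares immediately following the $m$-th green square (for $m=0$: the red squares before the first green square); these may be $0$. $\mathcal T_{n,k}^s$ is the set of such tilings with $b_m(T)\equiv0$ or $1\pmod{s+1}$ for all $m$. Each red square with exactly $m$ green squares to its left gets weight $x_{m+1}$, green squares get weight $1$, and $X^{w_T}$ is the product of the weights of all squares of $T$. $n_m(T)$ is the least nonnegative residue of $b_m(T)$ modulo $s+1$. -}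

module Defs where

open import Level using (Level)
open import Algebra.Bundles using (CommutativeRing)
open import Data.Nat as ℕ using (ℕ; zero; suc; _∸_; _%_; _≡ᵇ_; _<?_)
open import Data.Bool using (Bool; true; false; _∧_; _∨_)
open import Data.List as List using (List; []; _∷_; filter)
open import Data.Fin using (Fin; fromℕ<)
import Data.Nat.ListAction as ListAction
import Data.Bool.ListAction as BoolLA
open import Relation.Nullary using (yes; no)
open import Relation.Nullary.Decidable using (does)

data Colour : Set where
  red green : Colour

-- A tiling of an L-board is a word of length L over {r, g}.
Tiling : Set
Tiling = List Colour

allWords : ℕ → List Tiling
allWords zero    = [] ∷ []
allWords (suc L) = List.map (red ∷_) (allWords L) List.++ List.map (green ∷_) (allWords L)

countRed : Tiling → ℕ
countRed []            = 0
countRed (red ∷ w)     = suc (countRed w)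
countRed (green ∷ w)   = countRed w

countGreen : Tiling → ℕ
countGreen []          = 0
countGreen (red ∷ w)   = countGreen w
countGreen (green ∷ w) = suc (countGreen w)

-- blocks w = [b_0(T), b_1(T), ..., b_g(T)] where g = number of green squares:
-- b_0 = number of red squares before the first green one, and b_m = number
-- of consecutive red squares immediately following the m-th green square.
blocks : Tiling → List ℕ
blocks []          = 0 ∷ []
blocks (red ∷ w)   with blocks w
... | []     = 1 ∷ []          -- unreachable
... | b ∷ bs = suc b ∷ bs
blocks (green ∷ w) = 0 ∷ blocks w

okBlock : ℕ → ℕ → Bool
okBlock s b = (b % suc s ≡ᵇ 0) ∨ (b % suc s ≡ᵇ 1)

inT : ℕ → ℕ → ℕ → Tiling → Bool
inT n k s w = (countRed w ≡ᵇ k) ∧ (countGreen w ≡ᵇ (n ∸ 1)) ∧ BoolLA.and (List.map (okBlock s) (blocks w))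

𝒯 : ℕ → ℕ → ℕ → List Tiling
𝒯 n k s = List.filter (λ w → inT n k s w Data.Bool.≟ true) (allWords (n ℕ.+ k ∸ 1))
  where import Data.Bool

-- n_m(T) = b_m(T) mod (s+1);  G(T) = Σ_m n_m(T)
G : ℕ → Tiling → ℕ
G s w = ListAction.sum (List.map (λ b → b % suc s) (blocks w))

module RingDefs {c ℓ : Level} (R : CommutativeRing c ℓ) where
  open CommutativeRing R

  pow : Carrier → ℕ → Carrier
  pow a zero    = 1#
  pow a (suc m) = a * pow a m

  sign : ℕ → Carrier
  sign e = pow (- 1#) e

  -- formal power series in t as coefficient sequences
  Series : Set c
  Series = ℕ → Carrier

  oneS : Series
  oneS zero    = 1#
  oneS (suc _) = 0#

  convAux : Series → Series → ℕ → ℕ → Carrier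
  convAux f g m zero    = f 0 * g m
  convAux f g m (suc i) = f (suc i) * g (m ∸ suc i) + convAux f g m i

  _⊛_ : Series → Series → Series
  (f ⊛ g) m = convAux f g m m

  -- inverse of a power series with constant term 1:
  -- g_0 = 1, g_m = - Σ_{i=1}^{m} f_i g_{m-i}.
  -- invList f m = [g_m, g_{m-1}, ..., g_0]
  dot : Series → List Carrier → ℕ → Carrier
  dot f []       j = 0#
  dot f (g ∷ gs) j = f (suc j) * g + dot f gs (suc j)

  invList : Series → ℕ → List Carrier
  invList f zero    = 1# ∷ []
  invList f (suc m) = (- dot f (invList f m) 0) ∷ invList f m

  inv : Series → Series
  inv f m with invList f m
  ... | []     = 0#     -- unreachable
  ... | g ∷ _  = g

  factor : ℕ → Carrier → Series
  factor s x m with does (m ℕ.≤? s)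
  ... | true  = pow (- x) m
  ... | false = 0#

  prodS : {n : ℕ} → (Fin n → Series) → Series
  prodS {zero}  F = oneS
  prodS {suc n} F = F Fin.zero ⊛ prodS (λ i → F (Fin.suc i))
    where import Data.Fin as Fin

  -- H^{(s)}_k(x_1,...,x_n) = [t^k] Π_i (1 - x_i t + ... + (-x_i t)^s)^{-1}
  H : (s : ℕ) {n : ℕ} → (Fin n → Carrier) → ℕ → Carrier
  H s x k = prodS (λ i → inv (factor s (x i))) k

  -- x_{m+1} (0-indexed: x at position m); 0 outside the range (never used
  -- for tilings in 𝒯, which have n-1 green squares)
  xAt : {n : ℕ} → (Fin n → Carrier) → ℕ → Carrier
  xAt {n} x m with m <? n
  ... | yes p = x (fromℕ< p)
  ... | no _  = 0#

  -- X^{w_T}: product over red squares of x_{m+1}, m = #green squares to the left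
  weightFrom : {n : ℕ} → (Fin n → Carrier) → ℕ → Tiling → Carrier
  weightFrom x g []          = 1#
  weightFrom x g (red ∷ w)   = xAt x g * weightFrom x g w
  weightFrom x g (green ∷ w) = weightFrom x (suc g) w

  weight : {n : ℕ} → (Fin n → Carrier) → Tiling → Carrier
  weight x w = weightFrom x 0 w

  sumR : List Carrier → Carrier
  sumR = List.foldr _+_ 0#

-- For s ≥ 1, write y = x t. Then 1 - y + ⋯ + (-y)^s = (1 - (-y)^(s+1)) / (1 + y), so its
-- inverse (1 + y) Σ_q (-y)^(q(s+1)) has coefficient (-1)^(b - r) at y^b when r = b mod (s+1)
-- is 0 or 1, and 0 otherwise.  This coefficient is exactly the signed weight of a block of b red
-- squares.  Cutting a tiling at its first green square splits off the block coloured by x₁ and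
-- leaves a tiling in the remaining variables, which is the convolution recursion defining
-- H = Π_i (inverse factor in x_i).  For odd s the modulus s+1 is even, so b and b mod (s+1)
-- have the same parity and all the signs cancel.
module Submission where

open import Defs
open import Level using (Level)
open import Algebra.Bundles using (CommutativeRing)
import Algebra.Properties.CommutativeSemigroup as CommutativeSemigroupProperties
import Algebra.Properties.Group as GroupProperties
import Algebra.Properties.Ring as RingProperties
import Algebra.Solver.CommutativeMonoid as CommutativeMonoidSolver
open import Data.Bool using (Bool; true; false; _∧_; _∨_)
import Data.Bool as Bool
open import Data.Bool.ListAction using (and)
open import Data.Bool.Properties using (∧-zeroʳ; ∧-identityʳ; ∧-conicalˡ)
open import Data.Fin as Fin using (Fin)
open import Data.List using (List; []; _∷_; map; filter; applyDownFrom; _++_)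
open import Data.List.Properties using (map-++; map-∘)
open import Data.List.Relation.Binary.Pointwise using (Pointwise; []; _∷_)
open import Data.List.Relation.Unary.All using (All; []; _∷_)
open import Data.List.Relation.Unary.All.Properties using (all-filter)
open import Data.Nat as ℕ using (ℕ; zero; suc; _≥_; _%_; _≡ᵇ_; _≤_; _<_; z≤n; s≤s; _≤?_; _∸_)
open import Data.Nat.DivMod using (m≤n⇒m%n≡m; %-remove-+ˡ; m≡m%n+[m/n]*n; _/_)
open import Data.Nat.Divisibility using (∣-refl)
open import Data.Nat.ListAction using (sum)
import Data.Nat.Properties as ℕₚ
open import Data.Product using (_×_; _,_)
open import Function using (_∘_)
open import Relation.Binary.PropositionalEquality as ≡ using (_≡_; _≢_)
open import Relation.Nullary using (yes; no; contradiction)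
open import Relation.Nullary.Decidable using (dec-true; dec-false)

module Words where
  open import Data.Nat using (_+_; _∸_)
  open ≡ using (refl; cong; cong₂; trans)

  reds : ℕ → Tiling → Tiling
  reds zero    w = w
  reds (suc j) w = reds j (red ∷ w)

  countRed-reds : ∀ j w → countRed (reds j w) ≡ j + countRed w
  countRed-reds zero    w = refl
  countRed-reds (suc j) w = trans (countRed-reds j (red ∷ w)) (ℕₚ.+-suc j (countRed w))

  countGreen-reds : ∀ j w → countGreen (reds j w) ≡ countGreen w
  countGreen-reds zero    w = refl
  countGreen-reds (suc j) w = countGreen-reds j (red ∷ w)

  blocks-red∷ : ∀ w {b bs} → blocks w ≡ b ∷ bs → blocks (red ∷ w) ≡ suc b ∷ bs
  blocks-red∷ w eq with blocks w | eq
  ... | _ ∷ _ | refl = refl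

  blocks-reds : ∀ j {w b bs} → blocks w ≡ b ∷ bs → blocks (reds j w) ≡ j + b ∷ bs
  blocks-reds zero            eq = eq
  blocks-reds (suc j) {w} {b} {bs} eq =
    trans (blocks-reds j (blocks-red∷ w eq)) (cong (_∷ bs) (ℕₚ.+-suc j b))

  blocks-reds-green : ∀ j w → blocks (reds j (green ∷ w)) ≡ j ∷ blocks w
  blocks-reds-green j w = trans (blocks-reds j refl) (cong (_∷ blocks w) (ℕₚ.+-identityʳ j))

  blocks-reds-[] : ∀ j → blocks (reds j []) ≡ j ∷ []
  blocks-reds-[] j = trans (blocks-reds j refl) (cong (_∷ []) (ℕₚ.+-identityʳ j))

  countRed≡sum-blocks : ∀ w → countRed w ≡ sum (blocks w)
  countRed≡sum-blocks []          = refl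
  countRed≡sum-blocks (green ∷ w) = countRed≡sum-blocks w
  countRed≡sum-blocks (red ∷ w) with blocks w | countRed≡sum-blocks w
  ... | []    | eq = cong suc eq
  ... | _ ∷ _ | eq = cong suc eq

  +-cancelˡ-≡ᵇ : ∀ j m n → (j + m ≡ᵇ j + n) ≡ (m ≡ᵇ n)
  +-cancelˡ-≡ᵇ zero    m n = refl
  +-cancelˡ-≡ᵇ (suc j) m n = +-cancelˡ-≡ᵇ j m n

  allOk : ℕ → Tiling → Bool
  allOk s w = and (map (okBlock s) (blocks w))

  inT-reds-green : ∀ n j d s w →
    inT (suc n) (j + d) s (reds j (green ∷ w))
      ≡ (countRed w ≡ᵇ d) ∧ ((suc (countGreen w) ≡ᵇ n) ∧ (okBlock s j ∧ allOk s w))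
  inT-reds-green n j d s w = cong₂ _∧_
    (trans (cong (_≡ᵇ j + d) (countRed-reds j (green ∷ w))) (+-cancelˡ-≡ᵇ j (countRed w) d))
    (cong₂ _∧_ (cong (_≡ᵇ n) (countGreen-reds j (green ∷ w)))
               (cong (and ∘ map (okBlock s)) (blocks-reds-green j w)))

  inT-reds-[] : ∀ k s → inT 1 k s (reds k []) ≡ okBlock s k
  inT-reds-[] k s = trans
    (cong₂ _∧_
      (trans (cong (_≡ᵇ k) (trans (countRed-reds k []) (ℕₚ.+-identityʳ k))) (dec-true (k ℕ.≟ k) refl))
      (cong₂ _∧_ (cong (_≡ᵇ 0) (countGreen-reds k [])) (cong (and ∘ map (okBlock s)) (blocks-reds-[] k))))
    (∧-identityʳ (okBlock s k))

  inT₁-reds-green : ∀ k s j w → inT 1 k s (reds j (green ∷ w)) ≡ false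
  inT₁-reds-green k s j w = trans
    (cong (λ g → (countRed (reds j (green ∷ w)) ≡ᵇ k) ∧ ((g ≡ᵇ 0) ∧ allOk s (reds j (green ∷ w))))
          (countGreen-reds j (green ∷ w)))
    (∧-zeroʳ _)

  inT-excess-reds : ∀ n k s j w → k < j → inT n k s (reds j w) ≡ false
  inT-excess-reds n k s j w k<j =
    cong (_∧ ((countGreen (reds j w) ≡ᵇ n ∸ 1) ∧ allOk s (reds j w))) (dec-false (countRed (reds j w) ℕ.≟ k) too-many)
    where
    too-many : countRed (reds j w) ≢ k
    too-many eq = ℕₚ.<⇒≱ k<j
      (ℕₚ.≤-trans (ℕₚ.m≤m+n j (countRed w)) (ℕₚ.≤-reflexive (trans (≡.sym (countRed-reds j w)) eq)))

  inT⇒countRed≡ : ∀ n k s w → inT n k s w ≡ true → countRed w ≡ k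
  inT⇒countRed≡ n k s w eq = ℕₚ.≡ᵇ⇒≡ (countRed w) k (≡.subst Bool.T (≡.sym (∧-conicalˡ _ _ eq)) _)

open Words

module _ {c ℓ : Level} (R : CommutativeRing c ℓ) where
  open CommutativeRing R
  open RingDefs R
  open import Relation.Binary.Reasoning.Setoid setoid
  open RingProperties ring using (-1*x≈-x; -‿distribˡ-*)
  open GroupProperties +-group using (⁻¹-involutive; inverseˡ-unique)
  open CommutativeSemigroupProperties *-commutativeSemigroup using (x∙yz≈y∙xz)
  open CommutativeMonoidSolver *-commutativeMonoid using (solve; _⊕_; _⊜_)

  pow-+ : ∀ a i j → pow a (i ℕ.+ j) ≈ pow a i * pow a j
  pow-+ a zero    j = sym (*-identityˡ _)
  pow-+ a (suc i) j = trans (*-congˡ (pow-+ a i j)) (sym (*-assoc _ _ _))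

  sign-+ : ∀ i j → sign (i ℕ.+ j) ≈ sign i * sign j
  sign-+ = pow-+ (- 1#)

  -1*-1≈1 : - 1# * - 1# ≈ 1#
  -1*-1≈1 = trans (-1*x≈-x (- 1#)) (⁻¹-involutive 1#)

  sign-*2 : ∀ m → sign (m ℕ.* 2) ≈ 1#
  sign-*2 zero    = refl
  sign-*2 (suc m) = begin
    - 1# * (- 1# * sign (m ℕ.* 2)) ≈⟨ sym (*-assoc _ _ _) ⟩
    (- 1# * - 1#) * sign (m ℕ.* 2) ≈⟨ *-cong -1*-1≈1 (sign-*2 m) ⟩
    1# * 1#                        ≈⟨ *-identityˡ 1# ⟩
    1#                             ∎

  sign-square : ∀ m → sign m * sign m ≈ 1#
  sign-square m = begin
    sign m * sign m     ≈⟨ sym (sign-+ m m) ⟩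
    sign (m ℕ.+ m)      ≈⟨ reflexive (≡.cong sign m+m≡m*2) ⟩
    sign (m ℕ.* 2)      ≈⟨ sign-*2 m ⟩
    1#                  ∎
    where
    m+m≡m*2 : m ℕ.+ m ≡ m ℕ.* 2
    m+m≡m*2 = ≡.sym (≡.trans (ℕₚ.*-comm m 2) (≡.cong (m ℕ.+_) (ℕₚ.+-identityʳ m)))

  pow-neg : ∀ x i → pow (- x) i ≈ sign i * pow x i
  pow-neg x zero    = sym (*-identityˡ 1#)
  pow-neg x (suc i) = begin
    - x * pow (- x) i                ≈⟨ *-cong (sym (-1*x≈-x x)) (pow-neg x i) ⟩
    (- 1# * x) * (sign i * pow x i)  ≈⟨ solve 4 (λ m a s p → (m ⊕ a) ⊕ (s ⊕ p) ⊜ (m ⊕ s) ⊕ (a ⊕ p))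
                                              refl (- 1#) x (sign i) (pow x i) ⟩
    (- 1# * sign i) * (x * pow x i)  ∎

  x≈-1*y⇒x+y≈0 : ∀ {a b} → a ≈ - 1# * b → a + b ≈ 0#
  x≈-1*y⇒x+y≈0 {a} {b} a≈-b = trans (+-congʳ (trans a≈-b (-1*x≈-x b))) (-‿inverseˡ b)

  -x*y+x*y≈0 : ∀ x y → - x * y + x * y ≈ 0#
  -x*y+x*y≈0 x y = trans (+-congʳ (sym (-‿distribˡ-* x y))) (-‿inverseˡ (x * y))

  𝟙 : Bool → Carrier
  𝟙 true  = 1#
  𝟙 false = 0#

  𝟙-∧ : ∀ a b → 𝟙 (a ∧ b) ≈ 𝟙 a * 𝟙 b
  𝟙-∧ true  b = sym (*-identityˡ _)
  𝟙-∧ false b = sym (zeroˡ _)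

  blockCoeff : ℕ → ℕ → Carrier
  blockCoeff s b = 𝟙 (okBlock s b) * (sign b * sign (b % suc s))

  blockTerm : ℕ → Carrier → ℕ → Carrier
  blockTerm s x b = blockCoeff s b * pow x b

  blockCoeff-below : ∀ {s b} → b ≤ s → blockCoeff s b ≡ 𝟙 ((b ≡ᵇ 0) ∨ (b ≡ᵇ 1)) * (sign b * sign b)
  blockCoeff-below {s} {b} b≤s =
    ≡.cong (λ r → 𝟙 ((r ≡ᵇ 0) ∨ (r ≡ᵇ 1)) * (sign b * sign r)) (m≤n⇒m%n≡m b≤s)

  blockCoeff-periodic : ∀ s b → blockCoeff s (suc s ℕ.+ b) ≈ sign (suc s) * blockCoeff s b
  blockCoeff-periodic s b = begin
    blockCoeff s (suc s ℕ.+ b)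
      ≈⟨ reflexive (≡.cong (λ r → 𝟙 ((r ≡ᵇ 0) ∨ (r ≡ᵇ 1)) * (sign (suc s ℕ.+ b) * sign r))
                           (%-remove-+ˡ b ∣-refl)) ⟩
    𝟙 (okBlock s b) * (sign (suc s ℕ.+ b) * sign (b % suc s))
      ≈⟨ *-congˡ (*-congʳ (sign-+ (suc s) b)) ⟩
    𝟙 (okBlock s b) * ((sign (suc s) * sign b) * sign (b % suc s))
      ≈⟨ solve 4 (λ o p q r → o ⊕ ((p ⊕ q) ⊕ r) ⊜ p ⊕ (o ⊕ (q ⊕ r)))
               refl (𝟙 (okBlock s b)) (sign (suc s)) (sign b) (sign (b % suc s)) ⟩
    sign (suc s) * blockCoeff s b ∎

  blockTerm-zero : ∀ s x → blockTerm s x 0 ≈ 1#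
  blockTerm-zero s x = trans (*-identityʳ _) (trans (*-identityˡ _) (*-identityˡ 1#))

  blockTerm-one : ∀ s x → blockTerm (suc s) x 1 ≈ x
  blockTerm-one s x = begin
    blockCoeff (suc s) 1 * pow x 1  ≈⟨ *-congʳ (reflexive (blockCoeff-below {suc s} {1} (s≤s z≤n))) ⟩
    1# * (sign 1 * sign 1) * pow x 1 ≈⟨ *-cong (trans (*-identityˡ _) (sign-square 1)) (*-identityʳ x) ⟩
    1# * x                           ≈⟨ *-identityˡ x ⟩
    x                                ∎

  blockTerm-vanish : ∀ s x m → suc (suc m) ≤ s → blockTerm s x (suc (suc m)) ≈ 0#
  blockTerm-vanish s x m 2+m≤s =
    trans (*-congʳ (trans (reflexive (blockCoeff-below 2+m≤s)) (zeroˡ _))) (zeroˡ _)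

  blockTerm-periodic : ∀ s x e → blockTerm s x (suc s ℕ.+ e) + x * pow (- x) s * blockTerm s x e ≈ 0#
  blockTerm-periodic s x e = x≈-1*y⇒x+y≈0 (begin
    blockCoeff s (suc s ℕ.+ e) * pow x (suc s ℕ.+ e)
      ≈⟨ *-cong (blockCoeff-periodic s e) (*-congˡ (pow-+ x s e)) ⟩
    (- 1# * sign s * C) * (x * (pow x s * pow x e))
      ≈⟨ solve 6 (λ m S C X P Q → ((m ⊕ S) ⊕ C) ⊕ (X ⊕ (P ⊕ Q)) ⊜ m ⊕ ((X ⊕ (S ⊕ P)) ⊕ (C ⊕ Q)))
               refl (- 1#) (sign s) C x (pow x s) (pow x e) ⟩
    - 1# * (x * (sign s * pow x s) * (C * pow x e))
      ≈⟨ *-congˡ (*-congʳ (*-congˡ (sym (pow-neg x s)))) ⟩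
    - 1# * (x * pow (- x) s * blockTerm s x e) ∎)
    where C = blockCoeff s e

  factor-≤ : ∀ s x m → m ≤ s → factor s x m ≡ pow (- x) m
  factor-≤ s x m m≤s with m ℕ.≤ᵇ s | ℕₚ.≤⇒≤ᵇ m≤s
  ... | true | _ = ≡.refl

  factor-> : ∀ s x m → s < m → factor s x m ≡ 0#
  factor-> s x m s<m with m ℕ.≤ᵇ s | ℕₚ.≤ᵇ⇒≤ m s
  ... | true  | m≤s = contradiction (m≤s _) (ℕₚ.<⇒≱ s<m)
  ... | false | _   = ≡.refl

  dot-factor-beyond : ∀ s x L {j} → s ≤ j → dot (factor s x) L j ≈ 0#
  dot-factor-beyond s x []      s≤j = refl
  dot-factor-beyond s x (a ∷ L) {j} s≤j = begin
    factor s x (suc j) * a + dot (factor s x) L (suc j)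
      ≈⟨ +-cong (trans (*-congʳ (reflexive (factor-> s x (suc j) (s≤s s≤j)))) (zeroˡ a))
                (dot-factor-beyond s x L (ℕₚ.m≤n⇒m≤1+n s≤j)) ⟩
    0# + 0#  ≈⟨ +-identityˡ 0# ⟩
    0#       ∎

  at : List Carrier → ℕ → Carrier
  at []      _       = 0#
  at (a ∷ _) zero    = a
  at (_ ∷ L) (suc d) = at L d

  at-applyDownFrom-≤ : ∀ g {d m} → d ≤ m → at (applyDownFrom g (suc m)) d ≡ g (m ∸ d)
  at-applyDownFrom-≤ g {zero}  {m}     _         = ≡.refl
  at-applyDownFrom-≤ g {suc d} {suc m} (s≤s d≤m) = at-applyDownFrom-≤ g d≤m

  at-applyDownFrom-> : ∀ g {d m} → m < d → at (applyDownFrom g (suc m)) d ≡ 0#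
  at-applyDownFrom-> g {suc d} {zero}  _         = ≡.refl
  at-applyDownFrom-> g {suc d} {suc m} (s≤s m<d) = at-applyDownFrom-> g m<d

  -- The coefficients f i of factor s x satisfy f (i+1) = -x * f i except at i = s, where the
  -- truncation leaves the single correction term.
  dot-factor-shift : ∀ s x L j d → d ℕ.+ suc j ≡ s →
    dot (factor s x) L (suc j) ≈ - x * dot (factor s x) L j + x * pow (- x) s * at L d
  dot-factor-shift s x [] j d _ = sym (trans (+-cong (zeroʳ _) (zeroʳ _)) (+-identityʳ 0#))
  dot-factor-shift .(suc j) x (a ∷ L) j zero ≡.refl = begin
    f (2 ℕ.+ j) * a + dot f L (2 ℕ.+ j)
      ≈⟨ +-cong (trans (*-congʳ (reflexive (factor-> (suc j) x (2 ℕ.+ j) ℕₚ.≤-refl))) (zeroˡ a))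
                (dot-factor-beyond (suc j) x L (ℕₚ.n≤1+n _)) ⟩
    0# + 0#
      ≈⟨ trans (+-identityˡ 0#) (sym (-x*y+x*y≈0 x (p * a))) ⟩
    - x * (p * a) + x * (p * a)
      ≈⟨ +-cong (*-congˡ (sym (trans (+-cong (*-congʳ (reflexive (factor-≤ (suc j) x (suc j) ℕₚ.≤-refl)))
                                              (dot-factor-beyond (suc j) x L ℕₚ.≤-refl))
                                      (+-identityʳ _))))
                (sym (*-assoc x p a)) ⟩
    - x * (f (suc j) * a + dot f L (suc j)) + x * p * a ∎
    where f = factor (suc j) x
          p = pow (- x) (suc j)
  dot-factor-shift s x (a ∷ L) j (suc d) eq = begin
    f (2 ℕ.+ j) * a + dot f L (2 ℕ.+ j)
      ≈⟨ +-cong (*-congʳ (reflexive (factor-≤ s x (2 ℕ.+ j) 2+j≤s))) (dot-factor-shift s x L (suc j) d eq′) ⟩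
    (- x * pow (- x) (suc j)) * a + (- x * dot f L (suc j) + K * at L d)
      ≈⟨ sym (+-assoc _ _ _) ⟩
    ((- x * pow (- x) (suc j)) * a + - x * dot f L (suc j)) + K * at L d
      ≈⟨ +-congʳ (trans (+-congʳ (*-assoc _ _ _)) (sym (distribˡ (- x) _ _))) ⟩
    - x * (pow (- x) (suc j) * a + dot f L (suc j)) + K * at L d
      ≈⟨ +-congʳ (*-congˡ (+-congʳ (*-congʳ (reflexive (≡.sym (factor-≤ s x (suc j) 1+j≤s)))))) ⟩
    - x * (f (suc j) * a + dot f L (suc j)) + K * at L d ∎
    where f = factor s x
          K = x * pow (- x) s
          eq′ : d ℕ.+ suc (suc j) ≡ s
          eq′ = ≡.trans (ℕₚ.+-suc d (suc j)) eq
          2+j≤s : 2 ℕ.+ j ≤ s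
          2+j≤s = ≡.subst (2 ℕ.+ j ≤_) eq (s≤s (ℕₚ.m≤n+m (suc j) d))
          1+j≤s : suc j ≤ s
          1+j≤s = ℕₚ.≤-trans (ℕₚ.n≤1+n _) 2+j≤s

  blockTerm-correction : ∀ s′ x m →
    blockTerm (suc s′) x (2 ℕ.+ m) + x * pow (- x) (suc s′) * at (applyDownFrom (blockTerm (suc s′) x) (suc m)) s′ ≈ 0#
  blockTerm-correction s′ x m with s′ ≤? m
  ... | no s′≰m = begin
    blockTerm s x (2 ℕ.+ m) + K * at (applyDownFrom (blockTerm s x) (suc m)) s′
      ≈⟨ +-cong (blockTerm-vanish s x m (s≤s (ℕₚ.≰⇒> s′≰m)))
                (trans (*-congˡ (reflexive (at-applyDownFrom-> (blockTerm s x) (ℕₚ.≰⇒> s′≰m)))) (zeroʳ K)) ⟩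
    0# + 0# ≈⟨ +-identityˡ 0# ⟩
    0#      ∎
    where s = suc s′
          K = x * pow (- x) s
  ... | yes s′≤m with ℕₚ.m≤n⇒∃[o]m+o≡n s′≤m
  ... | e , ≡.refl = begin
    blockTerm s x (2 ℕ.+ (s′ ℕ.+ e)) + K * at (applyDownFrom (blockTerm s x) (suc (s′ ℕ.+ e))) s′
      ≈⟨ +-congˡ (*-congˡ (reflexive (≡.trans (at-applyDownFrom-≤ (blockTerm s x) s′≤m)
                                              (≡.cong (blockTerm s x) (ℕₚ.m+n∸m≡n s′ e))))) ⟩
    blockTerm s x (suc s ℕ.+ e) + K * blockTerm s x e ≈⟨ blockTerm-periodic s x e ⟩
    0# ∎
    where s = suc s′
          K = x * pow (- x) s

  blockTerm-recurrence : ∀ s′ x m →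
    blockTerm (suc s′) x (suc m) + dot (factor (suc s′) x) (applyDownFrom (blockTerm (suc s′) x) (suc m)) 0 ≈ 0#
  blockTerm-recurrence s′ x zero = begin
    blockTerm s x 1 + (f 1 * blockTerm s x 0 + 0#)
      ≈⟨ +-cong (blockTerm-one s′ x)
                (trans (+-identityʳ _) (*-cong (reflexive (factor-≤ s x 1 (s≤s z≤n))) (blockTerm-zero s x))) ⟩
    x + - x * 1# * 1# ≈⟨ +-congˡ (trans (*-identityʳ _) (*-identityʳ (- x))) ⟩
    x + - x           ≈⟨ -‿inverseʳ x ⟩
    0#                ∎
    where s = suc s′
          f = factor s x
  blockTerm-recurrence s′ x (suc m) = begin
    a (2 ℕ.+ m) + (f 1 * a (suc m) + dot f A 1)
      ≈⟨ +-congˡ (+-cong (*-congʳ f1≈-x) (dot-factor-shift s x A 0 s′ (ℕₚ.+-comm s′ 1))) ⟩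
    a (2 ℕ.+ m) + (- x * a (suc m) + (- x * dot f A 0 + C))
      ≈⟨ +-congˡ (trans (sym (+-assoc _ _ _)) (+-congʳ (sym (distribˡ (- x) _ _)))) ⟩
    a (2 ℕ.+ m) + (- x * (a (suc m) + dot f A 0) + C)
      ≈⟨ +-congˡ (trans (+-congʳ (trans (*-congˡ (blockTerm-recurrence s′ x m)) (zeroʳ _))) (+-identityˡ C)) ⟩
    a (2 ℕ.+ m) + C ≈⟨ blockTerm-correction s′ x m ⟩
    0# ∎
    where s = suc s′
          f = factor s x
          a = blockTerm s x
          A = applyDownFrom a (suc m)
          C = x * pow (- x) s * at A s′
          f1≈-x : f 1 ≈ - x
          f1≈-x = trans (reflexive (factor-≤ s x 1 (s≤s z≤n))) (*-identityʳ (- x))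

  dot-cong : ∀ f {L L′} → Pointwise _≈_ L L′ → ∀ j → dot f L j ≈ dot f L′ j
  dot-cong f []       j = refl
  dot-cong f (p ∷ ps) j = +-cong (*-congˡ p) (dot-cong f ps (suc j))

  invList-unique : ∀ f g → g 0 ≈ 1# → (∀ m → g (suc m) + dot f (applyDownFrom g (suc m)) 0 ≈ 0#) →
    ∀ m → Pointwise _≈_ (invList f m) (applyDownFrom g (suc m))
  invList-unique f g g0≈1 rec zero    = sym g0≈1 ∷ []
  invList-unique f g g0≈1 rec (suc m) =
    sym (trans (inverseˡ-unique _ _ (rec m)) (-‿cong (sym (dot-cong f earlier 0)))) ∷ earlier
    where earlier = invList-unique f g g0≈1 rec m

  inv-unique : ∀ f g → g 0 ≈ 1# → (∀ m → g (suc m) + dot f (applyDownFrom g (suc m)) 0 ≈ 0#) →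
    ∀ m → inv f m ≈ g m
  inv-unique f g g0≈1 rec m with invList f m | invList-unique f g g0≈1 rec m
  ... | _ ∷ _ | p ∷ _ = p

  inv-factor : ∀ s′ x m → inv (factor (suc s′) x) m ≈ blockTerm (suc s′) x m
  inv-factor s′ x = inv-unique _ _ (blockTerm-zero (suc s′) x) (blockTerm-recurrence s′ x)

  convAux-cong : ∀ {f f′ g g′} → (∀ i → f i ≈ f′ i) → (∀ i → g i ≈ g′ i) →
    ∀ m i → convAux f g m i ≈ convAux f′ g′ m i
  convAux-cong f≈ g≈ m zero    = *-cong (f≈ 0) (g≈ m)
  convAux-cong f≈ g≈ m (suc i) = +-cong (*-cong (f≈ _) (g≈ _)) (convAux-cong f≈ g≈ m i)

  convAux-oneS-below : ∀ f k i → i < k → convAux f oneS k i ≈ 0#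
  convAux-oneS-below f k zero    i<k = trans (*-congˡ (reflexive (oneS-pos i<k))) (zeroʳ _)
    where
    oneS-pos : ∀ {k} → 0 < k → oneS k ≡ 0#
    oneS-pos {suc _} _ = ≡.refl
  convAux-oneS-below f k (suc i) i<k =
    trans (+-cong (trans (*-congˡ (reflexive (oneS-∸ i<k))) (zeroʳ _))
                  (convAux-oneS-below f k i (ℕₚ.<-trans (ℕₚ.n<1+n i) i<k)))
          (+-identityˡ 0#)
    where
    oneS-∸ : ∀ {i k} → i < k → oneS (k ∸ i) ≡ 0#
    oneS-∸ {zero}  {suc k} _         = ≡.refl
    oneS-∸ {suc i} {suc k} (s≤s i<k) = oneS-∸ i<k

  ⊛-identityʳ : ∀ f k → (f ⊛ oneS) k ≈ f k
  ⊛-identityʳ f zero    = *-identityʳ _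
  ⊛-identityʳ f (suc k) =
    trans (+-cong (trans (*-congˡ (reflexive (≡.cong oneS (ℕₚ.n∸n≡0 k)))) (*-identityʳ _))
                  (convAux-oneS-below f (suc k) k (ℕₚ.n<1+n k)))
          (+-identityʳ _)

  sumFrom : (ℕ → Carrier) → ℕ → ℕ → Carrier
  sumFrom a j zero    = a j
  sumFrom a j (suc d) = a j + sumFrom a (suc j) d

  sumFrom-snoc : ∀ a j d → sumFrom a j (suc d) ≈ sumFrom a j d + a (suc d ℕ.+ j)
  sumFrom-snoc a j zero    = refl
  sumFrom-snoc a j (suc d) = trans (+-congˡ (sumFrom-snoc a (suc j) d))
    (trans (sym (+-assoc _ _ _)) (+-congˡ (reflexive (≡.cong (a ∘ suc) (ℕₚ.+-suc d j)))))

  convAux≈sumFrom : ∀ f g m i → convAux f g m i ≈ sumFrom (λ t → f t * g (m ∸ t)) 0 i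
  convAux≈sumFrom f g m zero    = refl
  convAux≈sumFrom f g m (suc i) = begin
    f (suc i) * g (m ∸ suc i) + convAux f g m i
      ≈⟨ +-comm _ _ ⟩
    convAux f g m i + f (suc i) * g (m ∸ suc i)
      ≈⟨ +-cong (convAux≈sumFrom f g m i) (reflexive (≡.cong a (≡.sym (ℕₚ.+-identityʳ (suc i))))) ⟩
    sumFrom a 0 i + a (suc i ℕ.+ 0)
      ≈⟨ sym (sumFrom-snoc a 0 i) ⟩
    sumFrom a 0 (suc i) ∎
    where a = λ t → f t * g (m ∸ t)

  sumR-++ : ∀ xs ys → sumR (xs ++ ys) ≈ sumR xs + sumR ys
  sumR-++ []       ys = sym (+-identityˡ _)
  sumR-++ (x ∷ xs) ys = trans (+-congˡ (sumR-++ xs ys)) (sym (+-assoc _ _ _))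

  sumR-map-cong-All : ∀ {A : Set} {P : A → Set} {φ ψ : A → Carrier} {l} → All P l →
    (∀ a → P a → φ a ≈ ψ a) → sumR (map φ l) ≈ sumR (map ψ l)
  sumR-map-cong-All {l = []}    []         φ≈ψ = refl
  sumR-map-cong-All {l = a ∷ l} (pa ∷ pas) φ≈ψ = +-cong (φ≈ψ a pa) (sumR-map-cong-All pas φ≈ψ)

  sumR-map-cong : ∀ {A : Set} {φ ψ : A → Carrier} (l : List A) → (∀ a → φ a ≈ ψ a) →
    sumR (map φ l) ≈ sumR (map ψ l)
  sumR-map-cong []      φ≈ψ = refl
  sumR-map-cong (a ∷ l) φ≈ψ = +-cong (φ≈ψ a) (sumR-map-cong l φ≈ψ)

  sumR-map-*ˡ : ∀ {A : Set} c (φ : A → Carrier) l → sumR (map (λ a → c * φ a) l) ≈ c * sumR (map φ l)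
  sumR-map-*ˡ c φ []      = sym (zeroʳ c)
  sumR-map-*ˡ c φ (a ∷ l) = trans (+-congˡ (sumR-map-*ˡ c φ l)) (sym (distribˡ c _ _))

  sumR-map-zero : ∀ {A : Set} {φ : A → Carrier} (l : List A) → (∀ a → φ a ≈ 0#) → sumR (map φ l) ≈ 0#
  sumR-map-zero []      φ≈0 = refl
  sumR-map-zero (a ∷ l) φ≈0 = trans (+-cong (φ≈0 a) (sumR-map-zero l φ≈0)) (+-identityˡ 0#)

  sumR-map-filter : ∀ {A : Set} (P : A → Bool) (φ : A → Carrier) l →
    sumR (map φ (filter (λ a → P a Bool.≟ true) l)) ≈ sumR (map (λ a → 𝟙 (P a) * φ a) l)
  sumR-map-filter P φ []      = refl
  sumR-map-filter P φ (a ∷ l) with P a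
  ... | true  = +-cong (sym (*-identityˡ _)) (sumR-map-filter P φ l)
  ... | false = trans (sumR-map-filter P φ l) (sym (trans (+-congʳ (zeroˡ _)) (+-identityˡ _)))

  sumWords : ℕ → (Tiling → Carrier) → Carrier
  sumWords L φ = sumR (map φ (allWords L))

  sumWords-suc : ∀ L φ → sumWords (suc L) φ ≈ sumWords L (φ ∘ (red ∷_)) + sumWords L (φ ∘ (green ∷_))
  sumWords-suc L φ = begin
    sumR (map φ (map (red ∷_) W ++ map (green ∷_) W))
      ≈⟨ reflexive (≡.cong sumR (map-++ φ (map (red ∷_) W) (map (green ∷_) W))) ⟩
    sumR (map φ (map (red ∷_) W) ++ map φ (map (green ∷_) W))
      ≈⟨ sumR-++ (map φ (map (red ∷_) W)) _ ⟩
    sumR (map φ (map (red ∷_) W)) + sumR (map φ (map (green ∷_) W))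
      ≈⟨ reflexive (≡.cong₂ (λ u v → sumR u + sumR v) (≡.sym (map-∘ W)) (≡.sym (map-∘ W))) ⟩
    sumWords L (φ ∘ (red ∷_)) + sumWords L (φ ∘ (green ∷_)) ∎
    where W = allWords L

  xAt-suc : ∀ {n} (x : Fin (suc n) → Carrier) g → xAt x (suc g) ≡ xAt (x ∘ Fin.suc) g
  xAt-suc {n} x g with suc g ℕ.<? suc n | g ℕ.<? n
  ... | yes _       | yes _   = ≡.refl
  ... | yes 1+g<1+n | no g≮n  = contradiction (ℕ.s<s⁻¹ 1+g<1+n) g≮n
  ... | no 1+g≮1+n  | yes g<n = contradiction (s≤s g<n) 1+g≮1+n
  ... | no _        | no _    = ≡.refl

  weightFrom-suc : ∀ {n} (x : Fin (suc n) → Carrier) g w → weightFrom x (suc g) w ≡ weightFrom (x ∘ Fin.suc) g w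
  weightFrom-suc x g []          = ≡.refl
  weightFrom-suc x g (red ∷ w)   = ≡.cong₂ _*_ (xAt-suc x g) (weightFrom-suc x g w)
  weightFrom-suc x g (green ∷ w) = weightFrom-suc x (suc g) w

  weightFrom-reds : ∀ {n} (x : Fin n → Carrier) g j w →
    weightFrom x g (reds j w) ≈ pow (xAt x g) j * weightFrom x g w
  weightFrom-reds x g zero    w = sym (*-identityˡ _)
  weightFrom-reds x g (suc j) w =
    trans (weightFrom-reds x g j (red ∷ w)) (trans (sym (*-assoc _ _ _)) (*-congʳ (*-comm _ _)))

  signedWeight : ℕ → (n k : ℕ) → (Fin n → Carrier) → Tiling → Carrier
  signedWeight s n k x w = 𝟙 (inT n k s w) * (sign k * (sign (G s w) * weight x w))

  tilingSum : ℕ → (n k : ℕ) → (Fin n → Carrier) → Carrier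
  tilingSum s n k x = sumWords (n ℕ.+ k ∸ 1) (signedWeight s n k x)

  signedWeight-vanish : ∀ s n k x w → inT n k s w ≡ false → signedWeight s n k x w ≈ 0#
  signedWeight-vanish s n k x w eq = trans (*-congʳ (reflexive (≡.cong 𝟙 eq))) (zeroˡ _)

  signedWeight-reds-green : ∀ s n (x : Fin (suc (suc n)) → Carrier) j d w →
    signedWeight s (suc (suc n)) (j ℕ.+ d) x (reds j (green ∷ w))
      ≈ blockTerm s (x Fin.zero) j * signedWeight s (suc n) d (x ∘ Fin.suc) w
  signedWeight-reds-green s n x j d w = begin
    𝟙 (inT (suc (suc n)) (j ℕ.+ d) s v) * (sign (j ℕ.+ d) * (sign (G s v) * weight x v))
      ≈⟨ *-cong (reflexive (≡.cong 𝟙 (inT-reds-green (suc n) j d s w)))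
                (*-congˡ (*-cong (reflexive (≡.cong (λ bs → sign (sum (map (_% suc s) bs))) (blocks-reds-green j w)))
                                 (trans (weightFrom-reds x 0 j (green ∷ w)) (*-congˡ (reflexive (weightFrom-suc x 0 w)))))) ⟩
    𝟙 (a ∧ (b ∧ (o ∧ A))) * (sign (j ℕ.+ d) * (sign (j % suc s ℕ.+ G s w) * (X * W)))
      ≈⟨ *-cong (trans (𝟙-∧ a _) (*-congˡ (trans (𝟙-∧ b _) (*-congˡ (𝟙-∧ o A)))))
                (*-cong (sign-+ j d) (*-congʳ (sign-+ (j % suc s) (G s w)))) ⟩
    (𝟙 a * (𝟙 b * (𝟙 o * 𝟙 A))) * ((sign j * sign d) * ((sign r * sign (G s w)) * (X * W)))
      ≈⟨ solve 10 (λ a b o A j d r g X W →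
                     (a ⊕ (b ⊕ (o ⊕ A))) ⊕ ((j ⊕ d) ⊕ ((r ⊕ g) ⊕ (X ⊕ W)))
                       ⊜ ((o ⊕ (j ⊕ r)) ⊕ X) ⊕ ((a ⊕ (b ⊕ A)) ⊕ (d ⊕ (g ⊕ W))))
               refl (𝟙 a) (𝟙 b) (𝟙 o) (𝟙 A) (sign j) (sign d) (sign r) (sign (G s w)) X W ⟩
    blockTerm s (x Fin.zero) j * ((𝟙 a * (𝟙 b * 𝟙 A)) * (sign d * (sign (G s w) * W)))
      ≈⟨ *-congˡ (*-congʳ (sym (trans (𝟙-∧ a _) (*-congˡ (𝟙-∧ b A))))) ⟩
    blockTerm s (x Fin.zero) j * signedWeight s (suc n) d (x ∘ Fin.suc) w ∎
    where
    v = reds j (green ∷ w)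
    a = countRed w ≡ᵇ d
    b = countGreen w ≡ᵇ n
    o = okBlock s j
    A = allOk s w
    r = j % suc s
    X = pow (x Fin.zero) j
    W = weight (x ∘ Fin.suc) w

  signedWeight-reds-[] : ∀ s (x : Fin 1 → Carrier) k → signedWeight s 1 k x (reds k []) ≈ blockTerm s (x Fin.zero) k
  signedWeight-reds-[] s x k = begin
    𝟙 (inT 1 k s (reds k [])) * (sign k * (sign (G s (reds k [])) * weight x (reds k [])))
      ≈⟨ *-cong (reflexive (≡.cong 𝟙 (inT-reds-[] k s)))
                (*-congˡ (*-cong (reflexive (≡.cong sign G≡)) (trans (weightFrom-reds x 0 k []) (*-identityʳ _)))) ⟩
    𝟙 (okBlock s k) * (sign k * (sign (k % suc s) * pow (x Fin.zero) k))
      ≈⟨ solve 4 (λ o p q X → o ⊕ (p ⊕ (q ⊕ X)) ⊜ (o ⊕ (p ⊕ q)) ⊕ X)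
               refl (𝟙 (okBlock s k)) (sign k) (sign (k % suc s)) (pow (x Fin.zero) k) ⟩
    blockTerm s (x Fin.zero) k ∎
    where
    G≡ : G s (reds k []) ≡ k % suc s
    G≡ = ≡.trans (≡.cong (λ bs → sum (map (_% suc s) bs)) (blocks-reds-[] k)) (ℕₚ.+-identityʳ _)

  tilingSum-green : ∀ s n (x : Fin (suc (suc n)) → Carrier) j d {L} → L ≡ n ℕ.+ d →
    sumWords L (λ w → signedWeight s (suc (suc n)) (j ℕ.+ d) x (reds j (green ∷ w)))
      ≈ blockTerm s (x Fin.zero) j * tilingSum s (suc n) (j ℕ.+ d ∸ j) (x ∘ Fin.suc)
  tilingSum-green s n x j d ≡.refl = begin
    sumWords (n ℕ.+ d) (λ w → signedWeight s (suc (suc n)) (j ℕ.+ d) x (reds j (green ∷ w)))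
      ≈⟨ sumR-map-cong (allWords (n ℕ.+ d)) (signedWeight-reds-green s n x j d) ⟩
    sumWords (n ℕ.+ d) (λ w → blockTerm s (x Fin.zero) j * signedWeight s (suc n) d (x ∘ Fin.suc) w)
      ≈⟨ sumR-map-*ˡ _ _ (allWords (n ℕ.+ d)) ⟩
    blockTerm s (x Fin.zero) j * tilingSum s (suc n) d (x ∘ Fin.suc)
      ≈⟨ *-congˡ (reflexive (≡.cong (λ e → tilingSum s (suc n) e (x ∘ Fin.suc)) (≡.sym (ℕₚ.m+n∸m≡n j d)))) ⟩
    blockTerm s (x Fin.zero) j * tilingSum s (suc n) (j ℕ.+ d ∸ j) (x ∘ Fin.suc) ∎

  tilingSum-after-reds : ∀ s n (x : Fin (suc (suc n)) → Carrier) k d j → j ℕ.+ d ≡ k →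
    sumWords (d ℕ.+ suc n) (λ w → signedWeight s (suc (suc n)) k x (reds j w))
      ≈ sumFrom (λ t → blockTerm s (x Fin.zero) t * tilingSum s (suc n) (k ∸ t) (x ∘ Fin.suc)) j d
  tilingSum-after-reds s n x .(j ℕ.+ 0) zero j ≡.refl = begin
    sumWords (suc n) (φ ∘ reds j)
      ≈⟨ sumWords-suc n (φ ∘ reds j) ⟩
    sumWords n (φ ∘ reds (suc j)) + sumWords n (λ w → φ (reds j (green ∷ w)))
      ≈⟨ +-cong (sumR-map-zero (allWords n)
                  (λ w → signedWeight-vanish s (suc (suc n)) (j ℕ.+ 0) x (reds (suc j) w)
                            (inT-excess-reds (suc (suc n)) (j ℕ.+ 0) s (suc j) w j+0<1+j)))
                (tilingSum-green s n x j 0 (≡.sym (ℕₚ.+-identityʳ n))) ⟩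
    0# + B ≈⟨ +-identityˡ B ⟩
    B ∎
    where
    φ = signedWeight s (suc (suc n)) (j ℕ.+ 0) x
    B = blockTerm s (x Fin.zero) j * tilingSum s (suc n) (j ℕ.+ 0 ∸ j) (x ∘ Fin.suc)
    j+0<1+j : j ℕ.+ 0 < suc j
    j+0<1+j = s≤s (ℕₚ.≤-reflexive (ℕₚ.+-identityʳ j))
  tilingSum-after-reds s n x .(j ℕ.+ suc d) (suc d) j ≡.refl =
    trans (sumWords-suc (d ℕ.+ suc n) (λ w → signedWeight s (suc (suc n)) (j ℕ.+ suc d) x (reds j w)))
      (trans (+-comm _ _)
        (+-cong (tilingSum-green s n x j (suc d) (≡.trans (ℕₚ.+-comm d (suc n)) (≡.sym (ℕₚ.+-suc n d))))
                (tilingSum-after-reds s n x (j ℕ.+ suc d) d (suc j) (≡.sym (ℕₚ.+-suc j d)))))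

  tilingSum₁-after-reds : ∀ s (x : Fin 1 → Carrier) k L j → j ℕ.+ L ≡ k →
    sumWords L (λ w → signedWeight s 1 k x (reds j w)) ≈ blockTerm s (x Fin.zero) k
  tilingSum₁-after-reds s x k zero j j+0≡k = trans (+-identityʳ _)
    (trans (reflexive (≡.cong (λ i → signedWeight s 1 k x (reds i [])) (≡.trans (≡.sym (ℕₚ.+-identityʳ j)) j+0≡k)))
           (signedWeight-reds-[] s x k))
  tilingSum₁-after-reds s x k (suc L) j j+1+L≡k = begin
    sumWords (suc L) (φ ∘ reds j)
      ≈⟨ sumWords-suc L (φ ∘ reds j) ⟩
    sumWords L (φ ∘ reds (suc j)) + sumWords L (λ w → φ (reds j (green ∷ w)))
      ≈⟨ +-cong (tilingSum₁-after-reds s x k L (suc j) (≡.trans (≡.sym (ℕₚ.+-suc j L)) j+1+L≡k))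
                (sumR-map-zero (allWords L) (λ w → signedWeight-vanish s 1 k x (reds j (green ∷ w)) (inT₁-reds-green k s j w))) ⟩
    blockTerm s (x Fin.zero) k + 0# ≈⟨ +-identityʳ _ ⟩
    blockTerm s (x Fin.zero) k ∎
    where φ = signedWeight s 1 k x

  H≈tilingSum : ∀ s′ n (x : Fin (suc n) → Carrier) k → H (suc s′) x k ≈ tilingSum (suc s′) (suc n) k x
  H≈tilingSum s′ zero x k = begin
    (inv (factor s (x Fin.zero)) ⊛ oneS) k ≈⟨ ⊛-identityʳ _ k ⟩
    inv (factor s (x Fin.zero)) k         ≈⟨ inv-factor s′ (x Fin.zero) k ⟩
    blockTerm s (x Fin.zero) k            ≈⟨ sym (tilingSum₁-after-reds s x k k 0 ≡.refl) ⟩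
    tilingSum s 1 k x                     ∎
    where s = suc s′
  H≈tilingSum s′ (suc n) x k = begin
    convAux (inv (factor s (x Fin.zero))) (H s y) k k
      ≈⟨ convAux-cong (inv-factor s′ (x Fin.zero)) (H≈tilingSum s′ n y) k k ⟩
    convAux a b k k
      ≈⟨ convAux≈sumFrom a b k k ⟩
    sumFrom (λ t → a t * b (k ∸ t)) 0 k
      ≈⟨ sym (tilingSum-after-reds s n x k k 0 ≡.refl) ⟩
    sumWords (k ℕ.+ suc n) (signedWeight s (suc (suc n)) k x)
      ≈⟨ reflexive (≡.cong (λ L → sumWords L (signedWeight s (suc (suc n)) k x)) (ℕₚ.+-comm k (suc n))) ⟩
    tilingSum s (suc (suc n)) k x ∎
    where s = suc s′
          y = x ∘ Fin.suc
          a = blockTerm s (x Fin.zero)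
          b = λ m → tilingSum s (suc n) m y

  tilingSum≈signed𝒯Sum : ∀ s n k (x : Fin n → Carrier) →
    tilingSum s n k x ≈ sign k * sumR (map (λ T → sign (G s T) * weight x T) (𝒯 n k s))
  tilingSum≈signed𝒯Sum s n k x = sym (begin
    sign k * sumR (map φ (𝒯 n k s))
      ≈⟨ *-congˡ (sumR-map-filter (λ w → inT n k s w) φ words) ⟩
    sign k * sumR (map (λ w → 𝟙 (inT n k s w) * φ w) words)
      ≈⟨ sym (sumR-map-*ˡ (sign k) _ words) ⟩
    sumR (map (λ w → sign k * (𝟙 (inT n k s w) * φ w)) words)
      ≈⟨ sumR-map-cong words (λ w → x∙yz≈y∙xz (sign k) (𝟙 (inT n k s w)) (φ w)) ⟩
    tilingSum s n k x ∎)
    where φ = λ T → sign (G s T) * weight x T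
          words = allWords (n ℕ.+ k ∸ 1)

  sign≈sign-% : ∀ {s} → s % 2 ≡ 1 → ∀ b → sign b ≈ sign (b % suc s)
  sign≈sign-% {s} s-odd b = begin
    sign b                                     ≈⟨ reflexive (≡.cong sign b≡) ⟩
    sign (b % suc s ℕ.+ (q ℕ.* v) ℕ.* 2)       ≈⟨ sign-+ (b % suc s) ((q ℕ.* v) ℕ.* 2) ⟩
    sign (b % suc s) * sign ((q ℕ.* v) ℕ.* 2)  ≈⟨ *-congˡ (sign-*2 (q ℕ.* v)) ⟩
    sign (b % suc s) * 1#                      ≈⟨ *-identityʳ _ ⟩
    sign (b % suc s)                           ∎
    where
    q = b / suc s
    v = suc (s / 2)
    1+s≡v*2 : suc s ≡ v ℕ.* 2
    1+s≡v*2 = ≡.cong suc (≡.trans (m≡m%n+[m/n]*n s 2) (≡.cong (ℕ._+ (s / 2) ℕ.* 2) s-odd))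
    b≡ : b ≡ b % suc s ℕ.+ (q ℕ.* v) ℕ.* 2
    b≡ = ≡.trans (m≡m%n+[m/n]*n b (suc s))
           (≡.trans (≡.cong (λ m → b % suc s ℕ.+ q ℕ.* m) 1+s≡v*2)
                    (≡.cong (b % suc s ℕ.+_) (≡.sym (ℕₚ.*-assoc q v 2))))

  sign-sum≈sign-sum-% : ∀ {s} → s % 2 ≡ 1 → ∀ bs → sign (sum bs) ≈ sign (sum (map (_% suc s) bs))
  sign-sum≈sign-sum-% s-odd []       = refl
  sign-sum≈sign-sum-% {s} s-odd (b ∷ bs) =
    trans (sign-+ b (sum bs))
      (trans (*-cong (sign≈sign-% s-odd b) (sign-sum≈sign-sum-% s-odd bs))
             (sym (sign-+ (b % suc s) (sum (map (_% suc s) bs)))))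

  signed𝒯Sum-odd : ∀ s n k (x : Fin n → Carrier) → s % 2 ≡ 1 →
    sign k * sumR (map (λ T → sign (G s T) * weight x T) (𝒯 n k s)) ≈ sumR (map (weight x) (𝒯 n k s))
  signed𝒯Sum-odd s n k x s-odd =
    trans (sym (sumR-map-*ˡ (sign k) _ (𝒯 n k s)))
          (sumR-map-cong-All (all-filter (λ w → inT n k s w Bool.≟ true) (allWords (n ℕ.+ k ∸ 1))) signs-cancel)
    where
    signs-cancel : ∀ T → inT n k s T ≡ true → sign k * (sign (G s T) * weight x T) ≈ weight x T
    signs-cancel T T∈𝒯 = begin
      sign k * (sign (G s T) * weight x T)         ≈⟨ sym (*-assoc _ _ _) ⟩
      (sign k * sign (G s T)) * weight x T          ≈⟨ *-congʳ (*-congʳ (reflexive (≡.cong sign k≡))) ⟩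
      (sign (sum (blocks T)) * sign (G s T)) * weight x T
                                                     ≈⟨ *-congʳ (*-congʳ (sign-sum≈sign-sum-% s-odd (blocks T))) ⟩
      (sign (G s T) * sign (G s T)) * weight x T    ≈⟨ *-congʳ (sign-square (G s T)) ⟩
      1# * weight x T                               ≈⟨ *-identityˡ _ ⟩
      weight x T                                    ∎
      where
      k≡ : k ≡ sum (blocks T)
      k≡ = ≡.trans (≡.sym (inT⇒countRed≡ n k s T T∈𝒯)) (countRed≡sum-blocks T)

theorem4p9 : {c ℓ : Level} (R : CommutativeRing c ℓ) →
  let open CommutativeRing R in
  let open RingDefs R in
  (k n s : ℕ) → k ≥ 1 → n ≥ 1 → s ≥ 1 → (x : Fin n → Carrier) →
    ((s % 2 ≡ 1) →
      H s x k ≈ sumR (map (λ T → weight x T) (𝒯 n k s)))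
    × ((s % 2 ≡ 0) →
      H s x k ≈ sign k * sumR (map (λ T → sign (G s T) * weight x T) (𝒯 n k s)))
theorem4p9 R k zero s _ () _ x
theorem4p9 R k (suc n) zero _ _ () x
theorem4p9 R k (suc n) (suc s′) _ _ _ x = odd , even
  where
  open CommutativeRing R using (_≈_; trans)
  signed : _ ≈ _
  signed = trans (H≈tilingSum R s′ n x k) (tilingSum≈signed𝒯Sum R (suc s′) (suc n) k x)
  odd : suc s′ % 2 ≡ 1 → _
  odd s-odd = trans signed (signed𝒯Sum-odd R (suc s′) (suc n) k x s-odd)
  -- The signed formula holds for every s ≥ 1.
  even : suc s′ % 2 ≡ 0 → _
  even _ = signed
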